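{- Let $d,r\ge1$ and let $w(x_1,\dots,x_k)$ be a group word that is $r$-bounded for $d$. Let $G$ be a group generated by $g_1,\dots,g_d$, viewed as a structure in the language $L$ of group theory expanded by constants $c_1,\dots,c_d$ interpreted as $g_1,\dots,g_d$, and suppose $G$ is $\Sigma_1$-pseudofinite with respect to $L$. Then $w(G)=w^{*r}(G)$. Moreover this hypothesis holds whenever $G$ is $\Pi_2$-pseudofinite with respect to the language of group theory, and in that case $w(G)$ is definable in $G$ by a $\Sigma_1$ formula without parameters in the language of group theory.
   Context: For a group $H$ and a word $w$ in $k$ variables, $w(H)$ is the verbal subgroup generated by all values $w(h_1,\dots,h_k)$, and $w^{*r}(H)$ is the set of products of at most $r$ values of $w$ or their inverses. The word $w$ is $r$-bounded for $d$ if $w(H)=w^{*r}(H)$ for every finite $d$-generated group $H$. For a language $L'$ (here with finitely many function and constant symbols, no relation symbols besides equality), an $L'$-structure is $\Sigma_r$-pseudofinite if every $\Pi_r$ sentence of $L'$ true in it holds in some finite $L'$-structure, and $\Pi_r$-pseudofinite if every $\Sigma_r$ sentence true in it holds in some finite $L'$-structure. -}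

module Defs where

open import Level using (0ℓ)
open import Data.Nat using (ℕ; zero; suc; _≤_)
open import Data.Fin using (Fin)
open import Data.Bool using (Bool; true; false)
open import Data.List using (List; []; _∷_; length; map; foldr)
open import Data.Product using (Σ; _×_; _,_)
open import Data.Sum using (_⊎_)
open import Data.Empty using (⊥)
open import Data.Unit using (⊤)
open import Relation.Nullary using (¬_)
open import Relation.Binary.PropositionalEquality using (_≡_)
open import Algebra.Structures using (IsGroup)
open import Function.Bundles using (_↔_)

record GroupOn : Set₁ where
  field
    Carrier : Set
    _∙_     : Carrier → Carrier → Carrier
    ε       : Carrier
    _⁻¹     : Carrier → Carrier
    isGroup : IsGroup _≡_ _∙_ ε _⁻¹

Finite : Set → Set
Finite A = Σ ℕ λ n → A ↔ Fin n

-- The language L_d : group language (·, ⁻¹, e) with d constants c_1..c_d.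
-- d = 0 is the pure language of group theory.

data Term (d n : ℕ) : Set where
  var : Fin n → Term d n
  con : Fin d → Term d n
  one : Term d n
  _·_ : Term d n → Term d n → Term d n
  inv : Term d n → Term d n

Word : ℕ → Set
Word k = Term 0 k

-- Arbitrary L_d-structures (not necessarily groups).
record Structure (d : ℕ) : Set₁ where
  field
    Carrier : Set
    op      : Carrier → Carrier → Carrier
    iv      : Carrier → Carrier
    unit    : Carrier
    cst     : Fin d → Carrier



evalT : ∀ {d n} (M : Structure d) → Term d n → (Fin n → Structure.Carrier M) → Structure.Carrier M
evalT M (var i) ρ = ρ i
evalT M (con c) ρ = Structure.cst M c
evalT M one ρ = Structure.unit M
evalT M (s · t) ρ = Structure.op M (evalT M s ρ) (evalT M t ρ)
evalT M (inv t) ρ = Structure.iv M (evalT M t ρ)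

data Formula (d : ℕ) : ℕ → Set where
  _≐_  : ∀ {n} → Term d n → Term d n → Formula d n
  ⊤f   : ∀ {n} → Formula d n
  ⊥f   : ∀ {n} → Formula d n
  ¬f   : ∀ {n} → Formula d n → Formula d n
  _∧f_ : ∀ {n} → Formula d n → Formula d n → Formula d n
  _∨f_ : ∀ {n} → Formula d n → Formula d n → Formula d n
  _⇒f_ : ∀ {n} → Formula d n → Formula d n → Formula d n
  ∀f   : ∀ {n} → Formula d (suc n) → Formula d n
  ∃f   : ∀ {n} → Formula d (suc n) → Formula d n

extend : ∀ {n} {A : Set} → A → (Fin n → A) → Fin (suc n) → A
extend a ρ Fin.zero = a
extend a ρ (Fin.suc i) = ρ i

-- Satisfaction (Tarskian; read classically via the excluded-middle
-- hypothesis of the main theorem).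
Sat : ∀ {d n} (M : Structure d) → Formula d n → (Fin n → Structure.Carrier M) → Set
Sat M (s ≐ t) ρ = evalT M s ρ ≡ evalT M t ρ
Sat M ⊤f ρ = ⊤
Sat M ⊥f ρ = ⊥
Sat M (¬f φ) ρ = ¬ Sat M φ ρ
Sat M (φ ∧f ψ) ρ = Sat M φ ρ × Sat M ψ ρ
Sat M (φ ∨f ψ) ρ = Sat M φ ρ ⊎ Sat M ψ ρ
Sat M (φ ⇒f ψ) ρ = Sat M φ ρ → Sat M ψ ρ
Sat M (∀f φ) ρ = (a : Structure.Carrier M) → Sat M φ (extend a ρ)
Sat M (∃f φ) ρ = Σ (Structure.Carrier M) λ a → Sat M φ (extend a ρ)

Sentence : ℕ → Set
Sentence d = Formula d 0

noVars : {A : Set} → Fin 0 → A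
noVars ()

_⊨_ : ∀ {d} (M : Structure d) → Sentence d → Set
M ⊨ φ = Sat M φ noVars

data QF {d : ℕ} : ∀ {n} → Formula d n → Set where
  qf-≐ : ∀ {n} {s t : Term d n} → QF (s ≐ t)
  qf-⊤ : ∀ {n} → QF {n = n} ⊤f
  qf-⊥ : ∀ {n} → QF {n = n} ⊥f
  qf-¬ : ∀ {n} {φ : Formula d n} → QF φ → QF (¬f φ)
  qf-∧ : ∀ {n} {φ ψ : Formula d n} → QF φ → QF ψ → QF (φ ∧f ψ)
  qf-∨ : ∀ {n} {φ ψ : Formula d n} → QF φ → QF ψ → QF (φ ∨f ψ)
  qf-⇒ : ∀ {n} {φ ψ : Formula d n} → QF φ → QF ψ → QF (φ ⇒f ψ)

-- Prenex hierarchy: Σ_0 = Π_0 = quantifier-free;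
-- Σ_{r+1} = ∃…∃ Π_r ; Π_{r+1} = ∀…∀ Σ_r  (blocks possibly empty).
data IsΣ {d : ℕ} : ℕ → ∀ {n} → Formula d n → Set
data IsΠ {d : ℕ} : ℕ → ∀ {n} → Formula d n → Set

data IsΣ {d} where
  Σ-qf : ∀ {n} {φ : Formula d n} → QF φ → IsΣ 0 φ
  Σ-Π  : ∀ {r n} {φ : Formula d n} → IsΠ r φ → IsΣ (suc r) φ
  Σ-∃  : ∀ {r n} {φ : Formula d (suc n)} → IsΣ (suc r) φ → IsΣ (suc r) (∃f φ)

data IsΠ {d} where
  Π-qf : ∀ {n} {φ : Formula d n} → QF φ → IsΠ 0 φ
  Π-Σ  : ∀ {r n} {φ : Formula d n} → IsΣ r φ → IsΠ (suc r) φ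
  Π-∀  : ∀ {r n} {φ : Formula d (suc n)} → IsΠ (suc r) φ → IsΠ (suc r) (∀f φ)

ΣPseudofinite : ∀ {d} → ℕ → Structure d → Set₁
ΣPseudofinite {d} r M =
  (φ : Sentence d) → IsΠ r φ → M ⊨ φ →
  Σ (Structure d) λ N → Finite (Structure.Carrier N) × (N ⊨ φ)

ΠPseudofinite : ∀ {d} → ℕ → Structure d → Set₁
ΠPseudofinite {d} r M =
  (φ : Sentence d) → IsΣ r φ → M ⊨ φ →
  Σ (Structure d) λ N → Finite (Structure.Carrier N) × (N ⊨ φ)

toStr : ∀ {d} (G : GroupOn) → (Fin d → GroupOn.Carrier G) → Structure d
toStr G g = record
  { Carrier = GroupOn.Carrier G
  ; op = GroupOn._∙_ G
  ; iv = GroupOn._⁻¹ G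
  ; unit = GroupOn.ε G
  ; cst = g }

Generates : ∀ {d} (G : GroupOn) → (Fin d → GroupOn.Carrier G) → Set
Generates {d} G g = ∀ x → Σ (Term d 0) λ t → evalT (toStr G g) t noVars ≡ x

module _ (G : GroupOn) {k : ℕ} (w : Word k) where
  open GroupOn G

  wval : (Fin k → Carrier) → Carrier
  wval h = evalT (toStr G noVars) w h

  factor : Bool × (Fin k → Carrier) → Carrier
  factor (true , h) = wval h
  factor (false , h) = wval h ⁻¹

  prod : List Carrier → Carrier
  prod = foldr _∙_ ε

  -- x ∈ w(G): the subgroup generated by the values of w, i.e. x is a finite
  -- product of values of w and their inverses.
  InVerbal : Carrier → Set
  InVerbal x = Σ (List (Bool × (Fin k → Carrier))) λ l → x ≡ prod (map factor l)

  InStar : ℕ → Carrier → Set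
  InStar r x = Σ (List (Bool × (Fin k → Carrier))) λ l →
               (length l ≤ r) × (x ≡ prod (map factor l))

VerbalEq : (G : GroupOn) → ∀ {k} → Word k → ℕ → Set
VerbalEq G w r = ∀ x → (InVerbal G w x → InStar G w r x) × (InStar G w r x → InVerbal G w x)

RBounded : ℕ → ℕ → ∀ {k} → Word k → Set₁
RBounded d r w =
  (H : GroupOn) → Finite (GroupOn.Carrier H) →
  (h : Fin d → GroupOn.Carrier H) → Generates H h → VerbalEq H w r

Σ1DefinableVerbal : (G : GroupOn) → ∀ {k} → Word k → Set
Σ1DefinableVerbal G w =
  Σ (Formula 0 1) λ φ → IsΣ 1 φ ×
    (∀ x → (InVerbal G w x → Sat (toStr G noVars) φ (λ _ → x))
         × (Sat (toStr G noVars) φ (λ _ → x) → InVerbal G w x))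

-- Write x ∈ w(G) as the value of a closed term P that is syntactically a product of values of w
-- at terms in the constants. If x ∉ w^{*r}(G), then (G, g) satisfies the Π₁ sentence "the group
-- axioms hold and P is not a product of at most r values of w and their inverses". A finite model
-- N of it is a group, P lies in w of the subgroup of N generated by the constants, so by
-- r-boundedness P ∈ w^{*r} there and hence in N: a contradiction. For the second part, a Π₁
-- sentence about (G, g) becomes a Σ₂ sentence of group theory once the constants are replaced by
-- existentially quantified variables, and a finite model of that sentence, with the witnesses as
-- constants, is a finite model of the original one. The Σ₁ formula "x is a product of at most r
-- values of w and their inverses" then defines w(G) = w^{*r}(G).
--
-- Excluded middle is used for the proof by contradiction and to cut the generated subgroup out of
-- the finite carrier as a decidable subset.

module Submission where

open import Defs
open import Level using (0ℓ)
open import Data.Nat using (ℕ; zero; suc; _+_; _≤_; z≤n; s≤s)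
open import Data.Nat.Properties using (m≤n⇒m≤1+n)
open import Data.Fin using (Fin; _↑ˡ_; _↑ʳ_) renaming (zero to fzero; suc to fsuc)
open import Data.Fin.Properties using (+↔⊎)
open import Data.Bool using (Bool; true; false; T)
open import Data.Bool.Properties using (T-irrelevant)
open import Data.List using (List; []; _∷_; [_]; length; map; foldr)
open import Data.List.Properties using (length-map)
open import Data.List.Relation.Unary.Any using (Any; here; there)
open import Data.List.Relation.Unary.Any.Properties using (singleton⁻)
open import Data.Product using (Σ; _×_; _,_; proj₁; proj₂; map₂)
open import Data.Product.Function.Dependent.Propositional using (Σ-↔)
open import Data.Sum using (_⊎_; inj₁; inj₂)
open import Data.Sum.Function.Propositional using (_⊎-↔_; _⊎-⇔_)
open import Data.Unit using (tt)
open import Relation.Nullary using (¬_)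
open import Relation.Nullary.Decidable using (isYes; toWitness; fromWitness; decidable-stable)
open import Relation.Binary.PropositionalEquality using (_≡_; refl; sym; trans; cong; cong₂; subst; isEquivalence)
open import Function using (_∘_)
open import Function.Bundles using (_↔_; _⇔_; mk↔ₛ′; mk⇔; Inverse; Equivalence)
open import Function.Properties.Inverse using (↔-refl; ↔-sym; ↔-trans)
open import Function.Construct.Identity using (⇔-id)
open import Function.Related.TypeIsomorphisms using (→-cong-⇔; ¬-cong-⇔)
open import Data.Product.Function.NonDependent.Propositional using (_×-⇔_)
open import Algebra.Structures using (IsGroup)
import Algebra.Definitions as Algebra
open import Axiom.ExcludedMiddle using (ExcludedMiddle)

open Equivalence using (to; from)

indicator : Bool → ℕ
indicator true = 1
indicator false = 0

count : ∀ {n} → (Fin n → Bool) → ℕ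
count {zero} b = 0
count {suc n} b = indicator (b fzero) + count (b ∘ fsuc)

T↔Fin-indicator : (b : Bool) → T b ↔ Fin (indicator b)
T↔Fin-indicator true = mk↔ₛ′ (λ _ → fzero) (λ _ → tt) (λ { fzero → refl ; (fsuc ()) }) (λ { tt → refl })
T↔Fin-indicator false = mk↔ₛ′ (λ ()) (λ ()) (λ ()) (λ ())

Σ-Fin-suc↔ : ∀ {n} (P : Fin (suc n) → Set) → Σ (Fin (suc n)) P ↔ (P fzero ⊎ Σ (Fin n) (P ∘ fsuc))
Σ-Fin-suc↔ P = mk↔ₛ′ split join (λ { (inj₁ _) → refl ; (inj₂ _) → refl }) (λ { (fzero , _) → refl ; (fsuc _ , _) → refl })
  where
  split : Σ _ P → P fzero ⊎ Σ _ (P ∘ fsuc)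
  split (fzero , p) = inj₁ p
  split (fsuc i , p) = inj₂ (i , p)
  join : P fzero ⊎ Σ _ (P ∘ fsuc) → Σ _ P
  join (inj₁ p) = fzero , p
  join (inj₂ (i , p)) = fsuc i , p

Σ-T↔Fin-count : ∀ {n} (b : Fin n → Bool) → Σ (Fin n) (T ∘ b) ↔ Fin (count b)
Σ-T↔Fin-count {zero} b = mk↔ₛ′ (λ { (() , _) }) (λ ()) (λ ()) (λ { (() , _) })
Σ-T↔Fin-count {suc n} b =
  ↔-trans (Σ-Fin-suc↔ (T ∘ b))
    (↔-trans (T↔Fin-indicator (b fzero) ⊎-↔ Σ-T↔Fin-count (b ∘ fsuc)) (↔-sym +↔⊎))

finite-Σ-T : ∀ {A : Set} → Finite A → (b : A → Bool) → Finite (Σ A (T ∘ b))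
finite-Σ-T (n , A↔Fin) b =
  count (b ∘ Inverse.from A↔Fin) ,
  ↔-trans (↔-sym (Σ-↔ (↔-sym A↔Fin) ↔-refl)) (Σ-T↔Fin-count (b ∘ Inverse.from A↔Fin))

Σ-T-≡ : ∀ {A : Set} {b : A → Bool} {u v : Σ A (T ∘ b)} → proj₁ u ≡ proj₁ v → u ≡ v
Σ-T-≡ {u = x , p} {v = .x , q} refl = cong (x ,_) (T-irrelevant p q)

forget : ∀ {d} → Structure d → Structure 0
forget M = record { Carrier = Carrier ; op = op ; iv = iv ; unit = unit ; cst = noVars }
  where open Structure M

withConstants : ∀ {d} (M : Structure 0) → (Fin d → Structure.Carrier M) → Structure d
withConstants M g = record { Carrier = Carrier ; op = op ; iv = iv ; unit = unit ; cst = g }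
  where open Structure M

ren : ∀ {d n m} → (Fin n → Fin m) → Term d n → Term d m
ren f (var i) = var (f i)
ren f (con c) = con c
ren f one = one
ren f (s · t) = ren f s · ren f t
ren f (inv t) = inv (ren f t)

sub : ∀ {d k n} → Word k → (Fin k → Term d n) → Term d n
sub (var i) σ = σ i
sub one σ = one
sub (s · t) σ = sub s σ · sub t σ
sub (inv t) σ = inv (sub t σ)

≡-cong-⇔ : ∀ {A : Set} {a a′ b b′ : A} → a ≡ a′ → b ≡ b′ → (a ≡ b) ⇔ (a′ ≡ b′)
≡-cong-⇔ refl refl = ⇔-id _

extend-cong : ∀ {n} {A : Set} (a : A) {ρ ρ′ : Fin n → A} →
              (∀ i → ρ i ≡ ρ′ i) → ∀ i → extend a ρ i ≡ extend a ρ′ i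
extend-cong a e fzero = refl
extend-cong a e (fsuc i) = e i

module _ {d} (M : Structure d) where
  open Structure M

  evalT-cong : ∀ {n} (t : Term d n) {ρ ρ′ : Fin n → Carrier} →
               (∀ i → ρ i ≡ ρ′ i) → evalT M t ρ ≡ evalT M t ρ′
  evalT-cong (var i) e = e i
  evalT-cong (con c) e = refl
  evalT-cong one e = refl
  evalT-cong (s · t) e = cong₂ op (evalT-cong s e) (evalT-cong t e)
  evalT-cong (inv t) e = cong iv (evalT-cong t e)

  evalT-ren : ∀ {n m} (f : Fin n → Fin m) (t : Term d n) {ρ : Fin n → Carrier} {ρ′ : Fin m → Carrier} →
              (∀ i → ρ′ (f i) ≡ ρ i) → evalT M (ren f t) ρ′ ≡ evalT M t ρ
  evalT-ren f (var i) e = e i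
  evalT-ren f (con c) e = refl
  evalT-ren f one e = refl
  evalT-ren f (s · t) e = cong₂ op (evalT-ren f s e) (evalT-ren f t e)
  evalT-ren f (inv t) e = cong iv (evalT-ren f t e)

  evalT-sub : ∀ {k n} (w : Word k) (σ : Fin k → Term d n) (ρ : Fin n → Carrier) →
              evalT M (sub w σ) ρ ≡ evalT (forget M) w (λ i → evalT M (σ i) ρ)
  evalT-sub (var i) σ ρ = refl
  evalT-sub one σ ρ = refl
  evalT-sub (s · t) σ ρ = cong₂ op (evalT-sub s σ ρ) (evalT-sub t σ ρ)
  evalT-sub (inv t) σ ρ = cong iv (evalT-sub t σ ρ)

  Sat-cong : ∀ {n} (φ : Formula d n) {ρ ρ′ : Fin n → Carrier} →
             (∀ i → ρ i ≡ ρ′ i) → Sat M φ ρ ⇔ Sat M φ ρ′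
  Sat-cong (s ≐ t) e = ≡-cong-⇔ (evalT-cong s e) (evalT-cong t e)
  Sat-cong ⊤f e = ⇔-id _
  Sat-cong ⊥f e = ⇔-id _
  Sat-cong (¬f φ) e = ¬-cong-⇔ (Sat-cong φ e)
  Sat-cong (φ ∧f ψ) e = Sat-cong φ e ×-⇔ Sat-cong ψ e
  Sat-cong (φ ∨f ψ) e = Sat-cong φ e ⊎-⇔ Sat-cong ψ e
  Sat-cong (φ ⇒f ψ) e = →-cong-⇔ (Sat-cong φ e) (Sat-cong ψ e)
  Sat-cong (∀f φ) e = mk⇔ (λ s a → to (Sat-cong φ (extend-cong a e)) (s a))
                          (λ s a → from (Sat-cong φ (extend-cong a e)) (s a))
  Sat-cong (∃f φ) e = mk⇔ (λ { (a , s) → a , to (Sat-cong φ (extend-cong a e)) s })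
                          (λ { (a , s) → a , from (Sat-cong φ (extend-cong a e)) s })

_++ᵉ_ : ∀ {k n} {A : Set} → (Fin k → A) → (Fin n → A) → Fin (k + n) → A
_++ᵉ_ {zero} ys ρ = ρ
_++ᵉ_ {suc k} ys ρ = extend (ys fzero) ((ys ∘ fsuc) ++ᵉ ρ)

++ᵉ-↑ˡ : ∀ {k n} {A : Set} (ys : Fin k → A) (ρ : Fin n → A) i → (ys ++ᵉ ρ) (i ↑ˡ n) ≡ ys i
++ᵉ-↑ˡ ys ρ fzero = refl
++ᵉ-↑ˡ ys ρ (fsuc i) = ++ᵉ-↑ˡ (ys ∘ fsuc) ρ i

++ᵉ-↑ʳ : ∀ {k n} {A : Set} (ys : Fin k → A) (ρ : Fin n → A) j → (ys ++ᵉ ρ) (k ↑ʳ j) ≡ ρ j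
++ᵉ-↑ʳ {zero} ys ρ j = refl
++ᵉ-↑ʳ {suc k} ys ρ j = ++ᵉ-↑ʳ (ys ∘ fsuc) ρ j

∀-block : ∀ {d} k {n} → Formula d (k + n) → Formula d n
∀-block zero φ = φ
∀-block (suc k) φ = ∀-block k (∀f φ)

∃-block : ∀ {d} k {n} → Formula d (k + n) → Formula d n
∃-block zero φ = φ
∃-block (suc k) φ = ∃-block k (∃f φ)

∃-closure : ∀ {d m} → Formula d m → Sentence d
∃-closure {m = zero} φ = φ
∃-closure {m = suc m} φ = ∃-closure (∃f φ)

∀-block-Π : ∀ {d} k {r n} {φ : Formula d (k + n)} → IsΠ (suc r) φ → IsΠ (suc r) (∀-block k φ)
∀-block-Π zero p = p
∀-block-Π (suc k) p = ∀-block-Π k (Π-∀ p)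

∃-block-Σ : ∀ {d} k {r n} {φ : Formula d (k + n)} → IsΣ (suc r) φ → IsΣ (suc r) (∃-block k φ)
∃-block-Σ zero p = p
∃-block-Σ (suc k) p = ∃-block-Σ k (Σ-∃ p)

∃-closure-Σ : ∀ {d m r} {φ : Formula d m} → IsΣ (suc r) φ → IsΣ (suc r) (∃-closure φ)
∃-closure-Σ {m = zero} p = p
∃-closure-Σ {m = suc m} p = ∃-closure-Σ (Σ-∃ p)

module _ {d} (M : Structure d) where
  open Structure M

  ∀-block-sat : ∀ k {n} (φ : Formula d (k + n)) (ρ : Fin n → Carrier) →
                Sat M (∀-block k φ) ρ ⇔ (∀ ys → Sat M φ (ys ++ᵉ ρ))
  ∀-block-sat zero φ ρ = mk⇔ (λ s _ → s) (λ s → s noVars)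
  ∀-block-sat (suc k) φ ρ = mk⇔ (λ s ys → to (∀-block-sat k (∀f φ) ρ) s (ys ∘ fsuc) (ys fzero))
                                (λ s → from (∀-block-sat k (∀f φ) ρ) (λ ys a → s (extend a ys)))

  ∃-block-sat : ∀ k {n} (φ : Formula d (k + n)) (ρ : Fin n → Carrier) →
                Sat M (∃-block k φ) ρ ⇔ Σ (Fin k → Carrier) λ ys → Sat M φ (ys ++ᵉ ρ)
  ∃-block-sat zero φ ρ = mk⇔ (λ s → noVars , s) proj₂
  ∃-block-sat (suc k) φ ρ = mk⇔
    (λ s → let (ys , a , s′) = to (∃-block-sat k (∃f φ) ρ) s in extend a ys , s′)
    (λ { (ys , s) → from (∃-block-sat k (∃f φ) ρ) (ys ∘ fsuc , ys fzero , s) })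

  ∃-closure-sat : ∀ {m} (φ : Formula d m) → Sat M (∃-closure φ) noVars ⇔ Σ (Fin m → Carrier) (Sat M φ)
  ∃-closure-sat {zero} φ = mk⇔ (λ s → noVars , s) (λ { (ρ , s) → from (Sat-cong M φ (λ ())) s })
  ∃-closure-sat {suc m} φ = mk⇔
    (λ s → let (ρ , a , s′) = to (∃-closure-sat (∃f φ)) s in extend a ρ , s′)
    (λ { (ρ , s) → from (∃-closure-sat (∃f φ)) (ρ ∘ fsuc , ρ fzero , from (Sat-cong M φ (extend-η ρ)) s) })
    where
    extend-η : (ρ : Fin (suc m) → Carrier) → ∀ i → extend (ρ fzero) (ρ ∘ fsuc) i ≡ ρ i
    extend-η ρ fzero = refl
    extend-η ρ (fsuc i) = refl

isGroup-≡ : ∀ {A : Set} {_∙_ : A → A → A} {ε : A} {_⁻¹ : A → A} →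
            Algebra.Associative _≡_ _∙_ → Algebra.Identity _≡_ ε _∙_ → Algebra.Inverse _≡_ ε _⁻¹ _∙_ →
            IsGroup _≡_ _∙_ ε _⁻¹
isGroup-≡ {_∙_ = _∙_} {_⁻¹ = _⁻¹} assoc identity inverse = record
  { isMonoid = record
    { isSemigroup = record
      { isMagma = record { isEquivalence = isEquivalence ; ∙-cong = cong₂ _∙_ }
      ; assoc = assoc }
    ; identity = identity }
  ; inverse = inverse
  ; ⁻¹-cong = cong _⁻¹ }

GroupLaws : ∀ {d} → Structure d → Set
GroupLaws M = IsGroup _≡_ op unit iv
  where open Structure M

groupOf : ∀ {d} (M : Structure d) → GroupLaws M → GroupOn
groupOf M laws = record { Carrier = Carrier ; _∙_ = op ; ε = unit ; _⁻¹ = iv ; isGroup = laws }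
  where open Structure M

groupAxiomsᶠ : ∀ {d n} → Formula d (3 + n)
groupAxiomsᶠ = (((x · y) · z) ≐ (x · (y · z)))
               ∧f (((one · x) ≐ x) ∧f (((x · one) ≐ x) ∧f (((inv x · x) ≐ one) ∧f ((x · inv x) ≐ one))))
  where
  x y z : ∀ {d n} → Term d (3 + n)
  x = var fzero
  y = var (fsuc fzero)
  z = var (fsuc (fsuc fzero))

groupAxiomsᶠ-sat : ∀ {d n} (M : Structure d) (ρ : Fin n → Structure.Carrier M) →
                   (∀ xyz → Sat M groupAxiomsᶠ (xyz ++ᵉ ρ)) ⇔ GroupLaws M
groupAxiomsᶠ-sat M ρ = mk⇔
  (λ s → let at x = s (triple x x x) in
    isGroup-≡ (λ x y z → proj₁ (s (triple x y z)))
              ((λ x → proj₁ (proj₂ (at x))) , (λ x → proj₁ (proj₂ (proj₂ (at x)))))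
              ((λ x → proj₁ (proj₂ (proj₂ (proj₂ (at x))))) , (λ x → proj₂ (proj₂ (proj₂ (proj₂ (at x)))))))
  (λ laws xyz → let open IsGroup laws in
     assoc _ _ _ , identityˡ _ , identityʳ _ , inverseˡ _ , inverseʳ _)
  where
  triple : ∀ {A : Set} → A → A → A → Fin 3 → A
  triple x y z = extend x (extend y (extend z noVars))

groupAxiomsᶠ-QF : ∀ {d n} → QF (groupAxiomsᶠ {d} {n})
groupAxiomsᶠ-QF = qf-∧ qf-≐ (qf-∧ qf-≐ (qf-∧ qf-≐ (qf-∧ qf-≐ qf-≐)))

record IsGroupHomomorphism (G H : GroupOn) (f : GroupOn.Carrier G → GroupOn.Carrier H) : Set where
  open GroupOn G using (_∙_; ε; _⁻¹)
  open GroupOn H using () renaming (_∙_ to _∙′_; ε to ε′; _⁻¹ to _⁻¹′)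
  field
    ∙-homo  : ∀ x y → f (x ∙ y) ≡ f x ∙′ f y
    ε-homo  : f ε ≡ ε′
    ⁻¹-homo : ∀ x → f (x ⁻¹) ≡ f x ⁻¹′

module _ {G H : GroupOn} {f : GroupOn.Carrier G → GroupOn.Carrier H} (homo : IsGroupHomomorphism G H f) where
  open IsGroupHomomorphism homo
  open GroupOn H using () renaming (_∙_ to _∙′_; _⁻¹ to _⁻¹′)

  evalT-homo : ∀ {d n} (g : Fin d → GroupOn.Carrier G) (h : Fin d → GroupOn.Carrier H) → (∀ c → f (g c) ≡ h c) →
               (t : Term d n) (ρ : Fin n → GroupOn.Carrier G) → f (evalT (toStr G g) t ρ) ≡ evalT (toStr H h) t (f ∘ ρ)
  evalT-homo g h g↦h (var i) ρ = refl
  evalT-homo g h g↦h (con c) ρ = g↦h c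
  evalT-homo g h g↦h one ρ = ε-homo
  evalT-homo g h g↦h (s · t) ρ = trans (∙-homo _ _) (cong₂ _∙′_ (evalT-homo g h g↦h s ρ) (evalT-homo g h g↦h t ρ))
  evalT-homo g h g↦h (inv t) ρ = trans (⁻¹-homo _) (cong _⁻¹′ (evalT-homo g h g↦h t ρ))

  module _ {k} (w : Word k) where

    factor-homo : ∀ p → f (factor G w p) ≡ factor H w (map₂ (f ∘_) p)
    factor-homo (true , h) = evalT-homo noVars noVars (λ ()) w h
    factor-homo (false , h) = trans (⁻¹-homo _) (cong _⁻¹′ (evalT-homo noVars noVars (λ ()) w h))

    prod-factor-homo : ∀ l → f (prod G w (map (factor G w) l)) ≡ prod H w (map (factor H w) (map (map₂ (f ∘_)) l))
    prod-factor-homo [] = ε-homo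
    prod-factor-homo (p ∷ l) = trans (∙-homo _ _) (cong₂ _∙′_ (factor-homo p) (prod-factor-homo l))

    inStar-homo : ∀ {m x} → InStar G w m x → InStar H w m (f x)
    inStar-homo (l , l≤m , x≡) =
      map (map₂ (f ∘_)) l , subst (_≤ _) (sym (length-map _ l)) l≤m , trans (cong f x≡) (prod-factor-homo l)

module GeneratedSubgroup (em : ExcludedMiddle 0ℓ) (G : GroupOn) {d} (g : Fin d → GroupOn.Carrier G) where
  open GroupOn G
  open IsGroup isGroup using (assoc; identityˡ; identityʳ; inverseˡ; inverseʳ)

  Generated : Carrier → Set
  Generated x = Σ (Term d 0) λ t → evalT (toStr G g) t noVars ≡ x

  isGenerated : Carrier → Bool
  isGenerated x = isYes (em {Generated x})

  private
    witness : ∀ {x} → T (isGenerated x) → Generated x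
    witness = toWitness {a? = em}

    generated : ∀ {x} → Generated x → T (isGenerated x)
    generated = fromWitness {a? = em}

  Carrierᴴ : Set
  Carrierᴴ = Σ Carrier (T ∘ isGenerated)

  _∙ᴴ_ : Carrierᴴ → Carrierᴴ → Carrierᴴ
  (x , p) ∙ᴴ (y , q) =
    let (s , s≡x) = witness p ; (t , t≡y) = witness q in x ∙ y , generated (s · t , cong₂ _∙_ s≡x t≡y)

  εᴴ : Carrierᴴ
  εᴴ = ε , generated (one , refl)

  _⁻¹ᴴ : Carrierᴴ → Carrierᴴ
  (x , p) ⁻¹ᴴ = let (t , t≡x) = witness p in x ⁻¹ , generated (inv t , cong _⁻¹ t≡x)

  subgroup : GroupOn
  subgroup = record
    { Carrier = Carrierᴴ ; _∙_ = _∙ᴴ_ ; ε = εᴴ ; _⁻¹ = _⁻¹ᴴ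
    ; isGroup = isGroup-≡ (λ _ _ _ → Σ-T-≡ (assoc _ _ _))
                          ((λ _ → Σ-T-≡ (identityˡ _)) , (λ _ → Σ-T-≡ (identityʳ _)))
                          ((λ _ → Σ-T-≡ (inverseˡ _)) , (λ _ → Σ-T-≡ (inverseʳ _))) }

  generators : Fin d → Carrierᴴ
  generators c = g c , generated (con c , refl)

  inclusion-homo : IsGroupHomomorphism subgroup G proj₁
  inclusion-homo = record { ∙-homo = λ _ _ → refl ; ε-homo = refl ; ⁻¹-homo = λ _ → refl }

  generators-generate : Generates subgroup generators
  generators-generate (x , p) =
    let (t , t≡x) = witness p in
    t , Σ-T-≡ (trans (evalT-homo inclusion-homo generators g (λ _ → refl) t noVars)
                     (trans (evalT-cong (toStr G g) t (λ ())) t≡x))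

  subgroup-finite : Finite Carrier → Finite Carrierᴴ
  subgroup-finite finite = finite-Σ-T finite isGenerated

module _ (G : GroupOn) {k : ℕ} (w : Word k) where
  open GroupOn G
  open IsGroup isGroup using (assoc; identityˡ; identityʳ)

  InStarFrom : ℕ → Carrier → Carrier → Set
  InStarFrom m a x = Σ (List (Bool × (Fin k → Carrier))) λ l →
                     (length l ≤ m) × (x ≡ a ∙ prod G w (map (factor G w) l))

  inStar⇔inStarFrom-ε : ∀ {m x} → InStar G w m x ⇔ InStarFrom m ε x
  inStar⇔inStarFrom-ε = mk⇔ (λ { (l , l≤m , x≡) → l , l≤m , trans x≡ (sym (identityˡ _)) })
                            (λ { (l , l≤m , x≡) → l , l≤m , trans x≡ (identityˡ _) })

  inStarFrom-zero : ∀ {a x} → InStarFrom 0 a x ⇔ (x ≡ a)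
  inStarFrom-zero = mk⇔ (λ { ([] , _ , x≡) → trans x≡ (identityʳ _) })
                        (λ x≡a → [] , z≤n , trans x≡a (sym (identityʳ _)))

  inStarFrom-weaken : ∀ {m a x} → InStarFrom m a x → InStarFrom (suc m) a x
  inStarFrom-weaken (l , l≤m , x≡) = l , m≤n⇒m≤1+n l≤m , x≡

  inStarFrom-cons : ∀ {m a x} p → InStarFrom m (a ∙ factor G w p) x → InStarFrom (suc m) a x
  inStarFrom-cons p (l , l≤m , x≡) = p ∷ l , s≤s l≤m , trans x≡ (assoc _ _ _)

  inStarFrom-uncons : ∀ {m a x} → InStarFrom (suc m) a x →
                      InStarFrom m a x ⊎ Σ (Bool × (Fin k → Carrier)) λ p → InStarFrom m (a ∙ factor G w p) x
  inStarFrom-uncons ([] , _ , x≡) = inj₁ ([] , z≤n , x≡)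
  inStarFrom-uncons (p ∷ l , s≤s l≤m , x≡) = inj₂ (p , l , l≤m , trans x≡ (sym (assoc _ _ _)))

  factor-cong : ∀ b {h h′ : Fin k → Carrier} → (∀ i → h i ≡ h′ i) → factor G w (b , h) ≡ factor G w (b , h′)
  factor-cong true e = evalT-cong (toStr G noVars) w e
  factor-cong false e = cong _⁻¹ (evalT-cong (toStr G noVars) w e)

-- Formulas expressing products of values of a word

module StarFormulas {d k : ℕ} (w : Word k) where

  factorᵗ : ∀ {n} → Bool × (Fin k → Term d n) → Term d n
  factorᵗ (true , σ) = sub w σ
  factorᵗ (false , σ) = inv (sub w σ)

  verbalTerm : ∀ {n} → List (Bool × (Fin k → Term d n)) → Term d n
  verbalTerm = foldr (λ p t → factorᵗ p · t) one

  weaken : ∀ {n} → Term d n → Term d (k + n)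
  weaken = ren (k ↑ʳ_)

  blockVars : ∀ {n} → Fin k → Term d (k + n)
  blockVars {n} i = var (i ↑ˡ n)

  extendProducts : ∀ {n} → List (Term d n) → List (Term d (k + n))
  extendProducts [] = []
  extendProducts (a ∷ as) =
    weaken a ∷ (weaken a · factorᵗ (true , blockVars)) ∷ (weaken a · factorᵗ (false , blockVars)) ∷ extendProducts as

  anyEqᶠ : ∀ {n} → Term d n → List (Term d n) → Formula d n
  anyEqᶠ t [] = ⊥f
  anyEqᶠ t (a ∷ as) = (t ≐ a) ∨f anyEqᶠ t as

  -- inStarᶠ m t [ one ] says that t is a product of at most m values of w and their inverses.
  -- Each step quantifies one fresh block ȳ of k variables and replaces every partial product a
  -- by a, a·w(ȳ), a·w(ȳ)⁻¹; sharing ȳ among all of them keeps the formula prenex.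
  inStarᶠ : ℕ → ∀ {n} → Term d n → List (Term d n) → Formula d n
  inStarᶠ zero t as = anyEqᶠ t as
  inStarᶠ (suc m) t as = ∃-block k (inStarᶠ m (weaken t) (extendProducts as))

  -- The group axioms are built in so that finite models of this Π₁ formula are groups.
  groupNotInStarᶠ : ℕ → ∀ {n} → Term d n → List (Term d n) → Formula d n
  groupNotInStarᶠ zero t as = ∀-block 3 (groupAxiomsᶠ ∧f ¬f (anyEqᶠ (ren (3 ↑ʳ_) t) (map (ren (3 ↑ʳ_)) as)))
  groupNotInStarᶠ (suc m) t as = ∀-block k (groupNotInStarᶠ m (weaken t) (extendProducts as))

  anyEqᶠ-QF : ∀ {n} (t : Term d n) as → QF (anyEqᶠ t as)
  anyEqᶠ-QF t [] = qf-⊥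
  anyEqᶠ-QF t (a ∷ as) = qf-∨ qf-≐ (anyEqᶠ-QF t as)

  inStarᶠ-Σ : ∀ m {n} (t : Term d n) as → IsΣ 1 (inStarᶠ m t as)
  inStarᶠ-Σ zero t as = Σ-Π (Π-qf (anyEqᶠ-QF t as))
  inStarᶠ-Σ (suc m) t as = ∃-block-Σ k (inStarᶠ-Σ m (weaken t) (extendProducts as))

  groupNotInStarᶠ-Π : ∀ m {n} (t : Term d n) as → IsΠ 1 (groupNotInStarᶠ m t as)
  groupNotInStarᶠ-Π zero t as = ∀-block-Π 3 (Π-Σ (Σ-qf (qf-∧ groupAxiomsᶠ-QF (qf-¬ (anyEqᶠ-QF _ _)))))
  groupNotInStarᶠ-Π (suc m) t as = ∀-block-Π k (groupNotInStarᶠ-Π m (weaken t) (extendProducts as))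

  module _ (M : Structure d) where
    open Structure M

    anyEqᶠ-ren : ∀ {n n′} (f : Fin n → Fin n′) {ρ : Fin n → Carrier} {ρ′ : Fin n′ → Carrier} →
                 (∀ i → ρ′ (f i) ≡ ρ i) → ∀ t as → Sat M (anyEqᶠ (ren f t) (map (ren f) as)) ρ′ ⇔ Sat M (anyEqᶠ t as) ρ
    anyEqᶠ-ren f e t [] = ⇔-id _
    anyEqᶠ-ren f e t (a ∷ as) = ≡-cong-⇔ (evalT-ren M f t e) (evalT-ren M f a e) ⊎-⇔ anyEqᶠ-ren f e t as

    groupNotInStarᶠ-sat : ∀ m {n} (t : Term d n) as ρ →
                          Sat M (groupNotInStarᶠ m t as) ρ ⇔ (GroupLaws M × ¬ Sat M (inStarᶠ m t as) ρ)
    groupNotInStarᶠ-sat zero {n} t as ρ = mk⇔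
      (λ s → let s′ = to (∀-block-sat M 3 matrix ρ) s in
        to (groupAxiomsᶠ-sat M ρ) (proj₁ ∘ s′) ,
        λ e → proj₂ (s′ (λ _ → unit)) (from (anyEqᶠ-ren (3 ↑ʳ_) (++ᵉ-↑ʳ {3} (λ _ → unit) ρ) t as) e))
      (λ { (laws , ¬e) → from (∀-block-sat M 3 matrix ρ) λ xyz →
        from (groupAxiomsᶠ-sat M ρ) laws xyz , ¬e ∘ to (anyEqᶠ-ren (3 ↑ʳ_) (++ᵉ-↑ʳ {3} xyz ρ) t as) })
      where
      matrix : Formula d (3 + n)
      matrix = groupAxiomsᶠ ∧f ¬f (anyEqᶠ (ren (3 ↑ʳ_) t) (map (ren (3 ↑ʳ_)) as))
    groupNotInStarᶠ-sat (suc m) t as ρ = mk⇔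
      (λ s → let s′ = to (∀-block-sat M k (groupNotInStarᶠ m (weaken t) (extendProducts as)) ρ) s in
        proj₁ (to (IH _) (s′ (λ _ → unit))) ,
        λ e → let (ys , e′) = to (∃-block-sat M k (inStarᶠ m (weaken t) (extendProducts as)) ρ) e in
              proj₂ (to (IH ys) (s′ ys)) e′)
      (λ { (laws , ¬e) → from (∀-block-sat M k (groupNotInStarᶠ m (weaken t) (extendProducts as)) ρ) λ ys →
        from (IH ys) (laws , λ e′ → ¬e (from (∃-block-sat M k (inStarᶠ m (weaken t) (extendProducts as)) ρ) (ys , e′))) })
      where
      IH : ∀ ys → Sat M (groupNotInStarᶠ m (weaken t) (extendProducts as)) (ys ++ᵉ ρ) ⇔
                  (GroupLaws M × ¬ Sat M (inStarᶠ m (weaken t) (extendProducts as)) (ys ++ᵉ ρ))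
      IH ys = groupNotInStarᶠ-sat m (weaken t) (extendProducts as) (ys ++ᵉ ρ)

  module _ (G : GroupOn) (g : Fin d → GroupOn.Carrier G) where
    open GroupOn G

    private
      M : Structure d
      M = toStr G g

    eval-factorᵗ : ∀ {n} (p : Bool × (Fin k → Term d n)) (ρ : Fin n → Carrier) →
                   evalT M (factorᵗ p) ρ ≡ factor G w (map₂ (λ σ i → evalT M (σ i) ρ) p)
    eval-factorᵗ (true , σ) ρ = evalT-sub M w σ ρ
    eval-factorᵗ (false , σ) ρ = cong _⁻¹ (evalT-sub M w σ ρ)

    eval-verbalTerm : ∀ {n} (L : List (Bool × (Fin k → Term d n))) (ρ : Fin n → Carrier) →
                      evalT M (verbalTerm L) ρ ≡ prod G w (map (factor G w) (map (map₂ (λ σ i → evalT M (σ i) ρ)) L))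
    eval-verbalTerm [] ρ = refl
    eval-verbalTerm (p ∷ L) ρ = cong₂ _∙_ (eval-factorᵗ p ρ) (eval-verbalTerm L ρ)

    verbalTerm-inVerbal : ∀ {n} L (ρ : Fin n → Carrier) → InVerbal G w (evalT M (verbalTerm L) ρ)
    verbalTerm-inVerbal L ρ = map (map₂ (λ σ i → evalT M (σ i) ρ)) L , eval-verbalTerm L ρ

    verbalTerm-of-generated : Generates G g → ∀ {x} → InVerbal G w x →
                              Σ (List (Bool × (Fin k → Term d 0))) λ L → evalT M (verbalTerm L) noVars ≡ x
    verbalTerm-of-generated gen (l , x≡) =
      map (map₂ names) l , trans (eval-verbalTerm (map (map₂ names) l) noVars) (trans (named l) (sym x≡))
      where
      names : (Fin k → Carrier) → Fin k → Term d 0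
      names h i = proj₁ (gen (h i))
      named : ∀ l → prod G w (map (factor G w) (map (map₂ (λ σ i → evalT M (σ i) noVars)) (map (map₂ names) l)))
                    ≡ prod G w (map (factor G w) l)
      named [] = refl
      named ((b , h) ∷ l) = cong₂ _∙_ (factor-cong G w b (λ i → proj₂ (gen (h i)))) (named l)

    eval-weaken : ∀ {n} (a : Term d n) ys (ρ : Fin n → Carrier) → evalT M (weaken a) (ys ++ᵉ ρ) ≡ evalT M a ρ
    eval-weaken a ys ρ = evalT-ren M (k ↑ʳ_) a (++ᵉ-↑ʳ ys ρ)

    eval-extendProduct : ∀ {n} (a : Term d n) b ys (ρ : Fin n → Carrier) →
                         evalT M (weaken a · factorᵗ (b , blockVars)) (ys ++ᵉ ρ) ≡ evalT M a ρ ∙ factor G w (b , ys)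
    eval-extendProduct a b ys ρ =
      cong₂ _∙_ (eval-weaken a ys ρ) (trans (eval-factorᵗ (b , blockVars) (ys ++ᵉ ρ)) (factor-cong G w b (++ᵉ-↑ˡ ys ρ)))

    Reaches : ℕ → ∀ {n} → (Fin n → Carrier) → Carrier → Term d n → Set
    Reaches m ρ x a = InStarFrom G w m (evalT M a ρ) x

    private
      shift : ∀ {m a a′ x} → a ≡ a′ → InStarFrom G w m a x → InStarFrom G w m a′ x
      shift {m} {x = x} = subst (λ a → InStarFrom G w m a x)

    extendProducts⁺ : ∀ {m n x} (as : List (Term d n)) (ρ : Fin n → Carrier) → Any (Reaches (suc m) ρ x) as →
                      Σ (Fin k → Carrier) λ ys → Any (Reaches m (ys ++ᵉ ρ) x) (extendProducts as)
    extendProducts⁺ (a ∷ as) ρ (here p) with inStarFrom-uncons G w p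
    ... | inj₁ q = (λ _ → ε) , here (shift (sym (eval-weaken a _ ρ)) q)
    ... | inj₂ ((true , ys) , q) = ys , there (here (shift (sym (eval-extendProduct a true ys ρ)) q))
    ... | inj₂ ((false , ys) , q) = ys , there (there (here (shift (sym (eval-extendProduct a false ys ρ)) q)))
    extendProducts⁺ (a ∷ as) ρ (there p) = let (ys , q) = extendProducts⁺ as ρ p in ys , there (there (there q))

    extendProducts⁻ : ∀ {m n x} (as : List (Term d n)) (ρ : Fin n → Carrier) ys →
                      Any (Reaches m (ys ++ᵉ ρ) x) (extendProducts as) → Any (Reaches (suc m) ρ x) as
    extendProducts⁻ (a ∷ as) ρ ys (here q) =
      here (inStarFrom-weaken G w (shift (eval-weaken a ys ρ) q))
    extendProducts⁻ (a ∷ as) ρ ys (there (here q)) =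
      here (inStarFrom-cons G w (true , ys) (shift (eval-extendProduct a true ys ρ) q))
    extendProducts⁻ (a ∷ as) ρ ys (there (there (here q))) =
      here (inStarFrom-cons G w (false , ys) (shift (eval-extendProduct a false ys ρ) q))
    extendProducts⁻ (a ∷ as) ρ ys (there (there (there q))) = there (extendProducts⁻ as ρ ys q)

    anyEqᶠ-sat : ∀ {n} (t : Term d n) as (ρ : Fin n → Carrier) →
                 Sat M (anyEqᶠ t as) ρ ⇔ Any (Reaches 0 ρ (evalT M t ρ)) as
    anyEqᶠ-sat t [] ρ = mk⇔ (λ ()) (λ ())
    anyEqᶠ-sat t (a ∷ as) ρ = mk⇔
      (λ { (inj₁ t≡a) → here (from (inStarFrom-zero G w) t≡a) ; (inj₂ s) → there (to (anyEqᶠ-sat t as ρ) s) })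
      (λ { (here q) → inj₁ (to (inStarFrom-zero G w) q) ; (there q) → inj₂ (from (anyEqᶠ-sat t as ρ) q) })

    inStarᶠ-sat : ∀ m {n} (t : Term d n) as (ρ : Fin n → Carrier) →
                  Sat M (inStarᶠ m t as) ρ ⇔ Any (Reaches m ρ (evalT M t ρ)) as
    inStarᶠ-sat zero t as ρ = anyEqᶠ-sat t as ρ
    inStarᶠ-sat (suc m) t as ρ = mk⇔
      (λ s → let (ys , s′) = to (∃-block-sat M k φ ρ) s in
        extendProducts⁻ as ρ ys (subst (reached ys) (eval-weaken t ys ρ) (to (IH ys) s′)))
      (λ p → let (ys , q) = extendProducts⁺ as ρ p in
        from (∃-block-sat M k φ ρ) (ys , from (IH ys) (subst (reached ys) (sym (eval-weaken t ys ρ)) q)))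
      where
      φ : Formula d (k + _)
      φ = inStarᶠ m (weaken t) (extendProducts as)
      reached : (Fin k → Carrier) → Carrier → Set
      reached ys x = Any (Reaches m (ys ++ᵉ ρ) x) (extendProducts as)
      IH : ∀ ys → Sat M φ (ys ++ᵉ ρ) ⇔ reached ys (evalT M (weaken t) (ys ++ᵉ ρ))
      IH ys = inStarᶠ-sat m (weaken t) (extendProducts as) (ys ++ᵉ ρ)

    inStarᶠ-one-sat : ∀ m {n} (t : Term d n) (ρ : Fin n → Carrier) →
                      Sat M (inStarᶠ m t [ one ]) ρ ⇔ InStar G w m (evalT M t ρ)
    inStarᶠ-one-sat m t ρ = mk⇔ (from (inStar⇔inStarFrom-ε G w) ∘ singleton⁻ ∘ to (inStarᶠ-sat m t [ one ] ρ))
                                (from (inStarᶠ-sat m t [ one ] ρ) ∘ here ∘ to (inStar⇔inStarFrom-ε G w))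

-- Transferring r-boundedness from finite groups

verbalTerm-inStar : ∀ {d r k} {w : Word k} → ExcludedMiddle 0ℓ → RBounded d r w →
                    (G : GroupOn) → Finite (GroupOn.Carrier G) → (g : Fin d → GroupOn.Carrier G) →
                    ∀ L → InStar G w r (evalT (toStr G g) (StarFormulas.verbalTerm w L) noVars)
verbalTerm-inStar {r = r} {w = w} em bounded G finite g L =
  subst (InStar G w r) (trans (evalT-homo inclusion-homo generators g (λ _ → refl) (verbalTerm L) noVars)
                              (evalT-cong (toStr G g) (verbalTerm L) (λ ())))
        (inStar-homo inclusion-homo w (proj₁ (bounded subgroup (subgroup-finite finite) generators generators-generate _)
                                              (verbalTerm-inVerbal subgroup generators L noVars)))
  where
  open GeneratedSubgroup em G g
  open StarFormulas w

Σ₁-pseudofinite⇒verbalTerm-inStar :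
  ∀ {d r k} {w : Word k} → ExcludedMiddle 0ℓ → RBounded d r w →
  (G : GroupOn) (g : Fin d → GroupOn.Carrier G) → ΣPseudofinite 1 (toStr G g) →
  ∀ L → InStar G w r (evalT (toStr G g) (StarFormulas.verbalTerm w L) noVars)
Σ₁-pseudofinite⇒verbalTerm-inStar {r = r} {w = w} em bounded G g pseudofinite L = decidable-stable em λ P∉ →
  let G⊨φ = from (groupNotInStarᶠ-sat (toStr G g) r P [ one ] noVars)
                 (GroupOn.isGroup G , P∉ ∘ to (inStarᶠ-one-sat G g r P noVars))
      (N , finite , N⊨φ) = pseudofinite (groupNotInStarᶠ r P [ one ]) (groupNotInStarᶠ-Π r P [ one ]) G⊨φ
      (laws , P∉N) = to (groupNotInStarᶠ-sat N r P [ one ] noVars) N⊨φ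
      N′ = groupOf N laws
  in P∉N (from (inStarᶠ-one-sat N′ (Structure.cst N) r P noVars)
               (verbalTerm-inStar em bounded N′ finite (Structure.cst N) L))
  where
  open StarFormulas w
  P : Term _ 0
  P = verbalTerm L

Σ₁-pseudofinite⇒verbal≡star :
  ∀ {d r k} {w : Word k} → ExcludedMiddle 0ℓ → RBounded d r w →
  (G : GroupOn) (g : Fin d → GroupOn.Carrier G) → Generates G g → ΣPseudofinite 1 (toStr G g) → VerbalEq G w r
Σ₁-pseudofinite⇒verbal≡star {r = r} {w = w} em bounded G g generate pseudofinite x =
  (λ x∈w → let (L , P≡x) = verbalTerm-of-generated G g generate x∈w in
           subst (InStar G w r) P≡x (Σ₁-pseudofinite⇒verbalTerm-inStar em bounded G g pseudofinite L)) ,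
  (λ { (l , _ , x≡) → l , x≡ })
  where open StarFormulas w

-- Naming constants by variables

abstractConstantsᵗ : ∀ {d n} → Term d n → Term 0 (n + d)
abstractConstantsᵗ {d} (var i) = var (i ↑ˡ d)
abstractConstantsᵗ {n = n} (con c) = var (n ↑ʳ c)
abstractConstantsᵗ one = one
abstractConstantsᵗ (s · t) = abstractConstantsᵗ s · abstractConstantsᵗ t
abstractConstantsᵗ (inv t) = inv (abstractConstantsᵗ t)

abstractConstants : ∀ {d n} → Formula d n → Formula 0 (n + d)
abstractConstants (s ≐ t) = abstractConstantsᵗ s ≐ abstractConstantsᵗ t
abstractConstants ⊤f = ⊤f
abstractConstants ⊥f = ⊥f
abstractConstants (¬f φ) = ¬f (abstractConstants φ)
abstractConstants (φ ∧f ψ) = abstractConstants φ ∧f abstractConstants ψ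
abstractConstants (φ ∨f ψ) = abstractConstants φ ∨f abstractConstants ψ
abstractConstants (φ ⇒f ψ) = abstractConstants φ ⇒f abstractConstants ψ
abstractConstants (∀f φ) = ∀f (abstractConstants φ)
abstractConstants (∃f φ) = ∃f (abstractConstants φ)

abstractConstants-QF : ∀ {d n} {φ : Formula d n} → QF φ → QF (abstractConstants φ)
abstractConstants-QF qf-≐ = qf-≐
abstractConstants-QF qf-⊤ = qf-⊤
abstractConstants-QF qf-⊥ = qf-⊥
abstractConstants-QF (qf-¬ p) = qf-¬ (abstractConstants-QF p)
abstractConstants-QF (qf-∧ p q) = qf-∧ (abstractConstants-QF p) (abstractConstants-QF q)
abstractConstants-QF (qf-∨ p q) = qf-∨ (abstractConstants-QF p) (abstractConstants-QF q)
abstractConstants-QF (qf-⇒ p q) = qf-⇒ (abstractConstants-QF p) (abstractConstants-QF q)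

abstractConstants-Σ : ∀ {d r n} {φ : Formula d n} → IsΣ r φ → IsΣ r (abstractConstants φ)
abstractConstants-Π : ∀ {d r n} {φ : Formula d n} → IsΠ r φ → IsΠ r (abstractConstants φ)
abstractConstants-Σ (Σ-qf p) = Σ-qf (abstractConstants-QF p)
abstractConstants-Σ (Σ-Π p) = Σ-Π (abstractConstants-Π p)
abstractConstants-Σ (Σ-∃ p) = Σ-∃ (abstractConstants-Σ p)
abstractConstants-Π (Π-qf p) = Π-qf (abstractConstants-QF p)
abstractConstants-Π (Π-Σ p) = Π-Σ (abstractConstants-Σ p)
abstractConstants-Π (Π-∀ p) = Π-∀ (abstractConstants-Π p)

module _ (M : Structure 0) {d} (g : Fin d → Structure.Carrier M) where
  open Structure M

  evalT-abstractConstants : ∀ {n} (t : Term d n) (ρ : Fin n → Carrier) →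
                            evalT (withConstants M g) t ρ ≡ evalT M (abstractConstantsᵗ t) (ρ ++ᵉ g)
  evalT-abstractConstants (var i) ρ = sym (++ᵉ-↑ˡ ρ g i)
  evalT-abstractConstants (con c) ρ = sym (++ᵉ-↑ʳ ρ g c)
  evalT-abstractConstants one ρ = refl
  evalT-abstractConstants (s · t) ρ = cong₂ op (evalT-abstractConstants s ρ) (evalT-abstractConstants t ρ)
  evalT-abstractConstants (inv t) ρ = cong iv (evalT-abstractConstants t ρ)

  abstractConstants-sat : ∀ {n} (φ : Formula d n) (ρ : Fin n → Carrier) →
                          Sat (withConstants M g) φ ρ ⇔ Sat M (abstractConstants φ) (ρ ++ᵉ g)
  abstractConstants-sat (s ≐ t) ρ = ≡-cong-⇔ (evalT-abstractConstants s ρ) (evalT-abstractConstants t ρ)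
  abstractConstants-sat ⊤f ρ = ⇔-id _
  abstractConstants-sat ⊥f ρ = ⇔-id _
  abstractConstants-sat (¬f φ) ρ = ¬-cong-⇔ (abstractConstants-sat φ ρ)
  abstractConstants-sat (φ ∧f ψ) ρ = abstractConstants-sat φ ρ ×-⇔ abstractConstants-sat ψ ρ
  abstractConstants-sat (φ ∨f ψ) ρ = abstractConstants-sat φ ρ ⊎-⇔ abstractConstants-sat ψ ρ
  abstractConstants-sat (φ ⇒f ψ) ρ = →-cong-⇔ (abstractConstants-sat φ ρ) (abstractConstants-sat ψ ρ)
  abstractConstants-sat (∀f φ) ρ = mk⇔ (λ s a → to (abstractConstants-sat φ (extend a ρ)) (s a))
                                       (λ s a → from (abstractConstants-sat φ (extend a ρ)) (s a))
  abstractConstants-sat (∃f φ) ρ = mk⇔ (λ { (a , s) → a , to (abstractConstants-sat φ (extend a ρ)) s })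
                                       (λ { (a , s) → a , from (abstractConstants-sat φ (extend a ρ)) s })

Π-pseudofinite⇒Σ-pseudofinite-withConstants :
  ∀ {r d} (M : Structure 0) (g : Fin d → Structure.Carrier M) →
  ΠPseudofinite (suc r) M → ΣPseudofinite r (withConstants M g)
Π-pseudofinite⇒Σ-pseudofinite-withConstants M g pseudofinite φ φ∈Π M⊨φ =
  let (N , finite , N⊨) = pseudofinite (∃-closure (abstractConstants φ))
                            (∃-closure-Σ (Σ-Π (abstractConstants-Π φ∈Π)))
                            (from (∃-closure-sat M (abstractConstants φ)) (g , to (abstractConstants-sat M g φ noVars) M⊨φ))
      (h , N⊨φ′) = to (∃-closure-sat N (abstractConstants φ)) N⊨
  in withConstants N h , finite , from (abstractConstants-sat N h φ noVars) N⊨φ′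

verbal-Σ₁-definable : ∀ {r k} (G : GroupOn) (w : Word k) → VerbalEq G w r → Σ1DefinableVerbal G w
verbal-Σ₁-definable {r} G w verbal≡star =
  inStarᶠ r (var fzero) [ one ] , inStarᶠ-Σ r (var fzero) [ one ] ,
  λ x → from (defines x) ∘ proj₁ (verbal≡star x) , proj₂ (verbal≡star x) ∘ to (defines x)
  where
  open StarFormulas w
  defines : ∀ x → Sat (toStr G noVars) (inStarᶠ r (var fzero) [ one ]) (λ _ → x) ⇔ InStar G w r x
  defines x = inStarᶠ-one-sat G noVars r (var fzero) (λ _ → x)

mainTheorem11 : ExcludedMiddle 0ℓ →
    (d r : ℕ) → 1 ≤ d → 1 ≤ r →
    {k : ℕ} (w : Word k) → RBounded d r w →
    (G : GroupOn) (g : Fin d → GroupOn.Carrier G) → Generates G g →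
    (ΣPseudofinite 1 (toStr G g) → VerbalEq G w r)
    × (ΠPseudofinite 2 (toStr G noVars) →
    ΣPseudofinite 1 (toStr G g) × Σ1DefinableVerbal G w)
mainTheorem11 em d r _ _ w bounded G g generate =
  verbal≡star ,
  λ Π₂-pseudofinite →
    let Σ₁-pseudofinite = Π-pseudofinite⇒Σ-pseudofinite-withConstants (toStr G noVars) g Π₂-pseudofinite
    in Σ₁-pseudofinite , verbal-Σ₁-definable G w (verbal≡star Σ₁-pseudofinite)
  where
  verbal≡star : ΣPseudofinite 1 (toStr G g) → VerbalEq G w r
  verbal≡star = Σ₁-pseudofinite⇒verbal≡star em bounded G g generate
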